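{- Let $w$ be a p-string having a period $p$. For every $\ell\in\mathbb{N}^+$ with $\ell p\le\frac{|w|}{|\Pi_w|+1}$ and every $a\in\Sigma\cup\Pi$: $p$ is a period of $wa$ if and only if $\ell p$ is a period of $wa$.
   Context: Let $\Sigma$ and $\Pi$ be disjoint alphabets; a p-string is a string over $\Sigma\cup\Pi$, indexed from 0, with $w[i:j]=w[i]\cdots w[j-1]$. A permutation $f$ of $\Pi$ acts on p-strings letterwise, fixing letters of $\Sigma$; $x\equiv y$ iff $f(x)=y$ for some permutation $f$ of $\Pi$. For $p\in\mathbb{N}^+$, $p\le|w|$, $p$ is a period of $w$ iff $w[0:|w|-p]\equiv w[p:|w|]$. $\Pi_w$ is the set of parameter characters occurring in $w$. -}

module Defs where

open import Data.Nat using (ℕ; _+_; _*_; _∸_; _≤_; _<_)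
open import Data.List using (List; []; _∷_; length; take; drop; map; _++_; [_]; deduplicate)
open import Data.Sum using (_⊎_; inj₁; inj₂)
open import Data.Product using (Σ; _×_)
open import Function.Bundles using (_↔_; Inverse)
open import Relation.Binary.PropositionalEquality using (_≡_)
open import Relation.Binary.Definitions using (DecidableEquality)

module PString (S P : Set) where

  -- letters of Σ ∪ Π (Σ and Π disjoint: a tagged sum)
  Letter : Set
  Letter = S ⊎ P

  PStr : Set
  PStr = List Letter

  actL : (P ↔ P) → Letter → Letter
  actL f (inj₁ s) = inj₁ s
  actL f (inj₂ π) = inj₂ (Inverse.to f π)

  act : (P ↔ P) → PStr → PStr
  act f = map (actL f)

  _≈ₚ_ : PStr → PStr → Set
  x ≈ₚ y = Σ (P ↔ P) λ f → act f x ≡ y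

  IsPeriod : ℕ → PStr → Set
  IsPeriod p w = (1 ≤ p) × (p ≤ length w) × (take (length w ∸ p) w ≈ₚ drop p w)

  params : PStr → List P
  params [] = []
  params (inj₁ _ ∷ w) = params w
  params (inj₂ π ∷ w) = π ∷ params w

  numParams : DecidableEquality P → PStr → ℕ
  numParams _≟_ w = length (deduplicate _≟_ (params w))

{-# OPTIONS --safe #-}
-- Multiples of a period are periods, which gives one direction. Conversely let q = ℓp,
-- n = |w|, and let f, g be the permutations witnessing the periods p of w and q of wa.
-- It suffices that a = f(w[n-p]); as w[n-p] = f^(ℓ-1)(b) and a = g(b) for b = w[n-q],
-- this says that g and f^ℓ agree on b. That is clear for b ∈ Σ. For b ∈ Π, the k + 1
-- letters at the positions n-q-kq, ..., n-q (k = |Π_w|) form a segment of an f^ℓ-orbit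
-- ending in b; letters of Σ are fixed by f^ℓ, so all of them are parameters, and by the
-- pigeonhole principle two coincide. The segment then repeats, so b already occurs at a
-- position e with e + q < n, where both g and f^ℓ send it to w[e+q].
module Submission where

open import Defs
open import Data.Nat using (ℕ; zero; suc; _+_; _*_; _∸_; _≤_; _<_; z≤n; s≤s; s≤s⁻¹)
open import Data.Nat.Properties
open import Data.Nat.Solver using (module +-*-Solver)
open +-*-Solver using (solve; _:+_; _:*_; _:=_; con)
open import Data.List using (List; []; _∷_; _++_; [_]; length; take; drop; map; deduplicate; lookup)
open import Data.List.Properties using (length-++-comm; length-++-≤ˡ)
open import Data.List.Membership.Propositional using (_∈_)
open import Data.List.Membership.Propositional.Properties using (∈-deduplicate⁺)
open import Data.List.Relation.Unary.Any using (here; there; index)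
open import Data.List.Relation.Unary.Any.Properties using (lookup-index)
open import Data.Maybe using (Maybe; just; nothing)
import Data.Maybe as Maybe
open import Data.Maybe.Properties using (just-injective; map-id; map-cong; map-∘)
open import Data.Fin using (Fin; toℕ) renaming (_<_ to _<ᶠ_)
open import Data.Fin.Properties using (pigeonhole; toℕ≤pred[n])
open import Data.Product using (_×_; _,_; proj₁; proj₂; ∃; ∃₂)
open import Data.Sum using (inj₁; inj₂)
open import Function using (_∘_; id)
open import Function.Bundles using (_↔_; _⇔_; mk⇔)
open import Function.Construct.Composition using (_↔-∘_)
open import Function.Construct.Identity using (↔-id)
open import Relation.Binary.Definitions using (DecidableEquality)
open import Relation.Binary.PropositionalEquality using (_≡_; refl; sym; trans; cong; cong₂; subst; subst₂; module ≡-Reasoning)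
open import Relation.Nullary using (yes; no)
open ≡-Reasoning

module _ {A : Set} where

  at : List A → ℕ → Maybe A
  at []       _       = nothing
  at (x ∷ xs) zero    = just x
  at (x ∷ xs) (suc i) = at xs i

  at-ext : ∀ (xs ys : List A) → (∀ i → at xs i ≡ at ys i) → xs ≡ ys
  at-ext []       []       _ = refl
  at-ext []       (_ ∷ _)  eq with () ← eq 0
  at-ext (_ ∷ _)  []       eq with () ← eq 0
  at-ext (x ∷ xs) (y ∷ ys) eq = cong₂ _∷_ (just-injective (eq 0)) (at-ext xs ys (eq ∘ suc))

  at-drop : ∀ m xs i → at (drop m xs) i ≡ at xs (m + i)
  at-drop zero    xs       i = refl
  at-drop (suc m) []       i = refl
  at-drop (suc m) (x ∷ xs) i = at-drop m xs i

  at-take< : ∀ {m i} xs → i < m → at (take m xs) i ≡ at xs i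
  at-take< {suc m}         []       _        = refl
  at-take< {suc m} {zero}  (x ∷ xs) _        = refl
  at-take< {suc m} {suc i} (x ∷ xs) (s≤s lt) = at-take< xs lt

  at-take≥ : ∀ {m i} xs → m ≤ i → at (take m xs) i ≡ nothing
  at-take≥ xs       z≤n       = refl
  at-take≥ []       (s≤s m≤i) = refl
  at-take≥ (x ∷ xs) (s≤s m≤i) = at-take≥ xs m≤i

  at-≥length : ∀ {i} xs → length xs ≤ i → at xs i ≡ nothing
  at-≥length []       _         = refl
  at-≥length (x ∷ xs) (s≤s le) = at-≥length xs le

  at-just⇒< : ∀ {i x} xs → at xs i ≡ just x → i < length xs
  at-just⇒< {zero}  (_ ∷ _)  _  = s≤s z≤n
  at-just⇒< {suc i} (_ ∷ xs) eq = s≤s (at-just⇒< xs eq)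

  at-<⇒just : ∀ {i} xs → i < length xs → ∃ λ x → at xs i ≡ just x
  at-<⇒just {zero}  (x ∷ _)  _        = x , refl
  at-<⇒just {suc i} (_ ∷ xs) (s≤s lt) = at-<⇒just xs lt

  at-++ˡ : ∀ {i} xs {ys} → i < length xs → at (xs ++ ys) i ≡ at xs i
  at-++ˡ {zero}  (_ ∷ _)  _        = refl
  at-++ˡ {suc i} (_ ∷ xs) (s≤s lt) = at-++ˡ xs lt

  at-length-++ : ∀ xs {x ys} → at (xs ++ x ∷ ys) (length xs) ≡ just x
  at-length-++ []       = refl
  at-length-++ (_ ∷ xs) = at-length-++ xs

at-map : ∀ {A B : Set} (h : A → B) xs i → at (map h xs) i ≡ Maybe.map h (at xs i)
at-map h []       i       = refl
at-map h (x ∷ xs) zero    = refl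
at-map h (x ∷ xs) (suc i) = at-map h xs i

Recurrence : {A : Set} → (A → A) → ℕ → (ℕ → A) → Set
Recurrence h k y = ∀ u → u < k → y (suc u) ≡ h (y u)

module _ {A : Set} (h : A → A) {k : ℕ} {y : ℕ → A} (rec : Recurrence h k y) where

  recurrence-+suc : ∀ u j → u + suc j ≤ k → y (u + suc j) ≡ h (y (u + j))
  recurrence-+suc u j le =
    trans (cong y (+-suc u j)) (rec (u + j) (subst (_≤ k) (+-suc u j) le))

  recurrence-fixed : ∀ {c u} → h c ≡ c → y u ≡ c → u ≤ k → y k ≡ c
  recurrence-fixed {c} {u} hc≡c yu≡c u≤k =
    subst (λ v → y v ≡ c) (m+[n∸m]≡n u≤k) (go (k ∸ u) (≤-reflexive (m+[n∸m]≡n u≤k)))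
    where
    go : ∀ d → u + d ≤ k → y (u + d) ≡ c
    go zero    _  = trans (cong y (+-identityʳ u)) yu≡c
    go (suc d) le = begin
      y (u + suc d)  ≡⟨ recurrence-+suc u d le ⟩
      h (y (u + d))  ≡⟨ cong h (go d (≤-trans (+-monoʳ-≤ u (n≤1+n d)) le)) ⟩
      h c            ≡⟨ hc≡c ⟩
      c              ∎

  recurrence-shift : ∀ {u v} → u ≤ v → y u ≡ y v → ∀ j → v + j ≤ k → y (u + j) ≡ y (v + j)
  recurrence-shift {u} {v} _ yu≡yv zero _ =
    trans (cong y (+-identityʳ u)) (trans yu≡yv (cong y (sym (+-identityʳ v))))
  recurrence-shift {u} {v} u≤v yu≡yv (suc j) le = begin
    y (u + suc j)  ≡⟨ recurrence-+suc u j (≤-trans (+-monoˡ-≤ (suc j) u≤v) le) ⟩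
    h (y (u + j))  ≡⟨ cong h (recurrence-shift u≤v yu≡yv j (≤-trans (+-monoʳ-≤ v (n≤1+n j)) le)) ⟩
    h (y (v + j))  ≡⟨ sym (recurrence-+suc v j le) ⟩
    y (v + suc j)  ∎

pigeonhole-∈ : ∀ {A : Set} (xs : List A) (σ : ℕ → A) → (∀ u → u ≤ length xs → σ u ∈ xs) →
               ∃₂ λ u v → u < v × v ≤ length xs × σ u ≡ σ v
pigeonhole-∈ xs σ σ∈xs = collide (pigeonhole (n<1+n (length xs)) (index ∘ member))
  where
  member : (t : Fin (suc (length xs))) → σ (toℕ t) ∈ xs
  member t = σ∈xs (toℕ t) (toℕ≤pred[n] t)

  collide : (∃₂ λ s t → s <ᶠ t × index (member s) ≡ index (member t)) →
            ∃₂ λ u v → u < v × v ≤ length xs × σ u ≡ σ v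
  collide (s , t , s<t , index≡) = toℕ s , toℕ t , s<t , toℕ≤pred[n] t , (begin
    σ (toℕ s)                      ≡⟨ lookup-index (member s) ⟩
    lookup xs (index (member s))   ≡⟨ cong (lookup xs) index≡ ⟩
    lookup xs (index (member t))   ≡⟨ lookup-index (member t) ⟨
    σ (toℕ t)                      ∎)

m*[k+1]≤n⇒m≤n : ∀ {m k n} → m * (k + 1) ≤ n → m ≤ n
m*[k+1]≤n⇒m≤n {m} {k} = ≤-trans (subst (_≤ m * (k + 1)) (*-identityʳ m) (*-monoʳ-≤ m (m≤n+m 1 k)))

module Periods (S P : Set) where
  open PString S P

  _^_ : (P ↔ P) → ℕ → (P ↔ P)
  f ^ zero  = ↔-id P
  f ^ suc j = f ↔-∘ (f ^ j)

  actL-id : ∀ x → actL (↔-id P) x ≡ x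
  actL-id (inj₁ _) = refl
  actL-id (inj₂ _) = refl

  actL-∘ : ∀ f g x → actL (f ↔-∘ g) x ≡ actL f (actL g x)
  actL-∘ f g (inj₁ _) = refl
  actL-∘ f g (inj₂ _) = refl

  at-∈-params : ∀ w {i π} → at w i ≡ just (inj₂ π) → π ∈ params w
  at-∈-params (inj₂ _ ∷ w) {zero}  refl = here refl
  at-∈-params (inj₁ _ ∷ w) {suc i} eq   = at-∈-params w eq
  at-∈-params (inj₂ _ ∷ w) {suc i} eq   = there (at-∈-params w eq)

  record Shifts (f : P ↔ P) (q : ℕ) (v : PStr) : Set where
    field
      shift : ∀ i → i + q < length v → at v (i + q) ≡ Maybe.map (actL f) (at v i)

  open Shifts

  IsPeriod⇒Shifts : ∀ {q v} → IsPeriod q v → ∃ λ f → Shifts f q v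
  IsPeriod⇒Shifts {q} {v} (_ , _ , f , f[prefix]≡suffix) = f , record { shift = pointwise }
    where
    pointwise : ∀ i → i + q < length v → at v (i + q) ≡ Maybe.map (actL f) (at v i)
    pointwise i i+q<n = begin
      at v (i + q)                                      ≡⟨ cong (at v) (+-comm i q) ⟩
      at v (q + i)                                      ≡⟨ sym (at-drop q v i) ⟩
      at (drop q v) i                                   ≡⟨ cong (λ u → at u i) (sym f[prefix]≡suffix) ⟩
      at (act f (take (length v ∸ q) v)) i              ≡⟨ at-map (actL f) (take (length v ∸ q) v) i ⟩
      Maybe.map (actL f) (at (take (length v ∸ q) v) i) ≡⟨ cong (Maybe.map (actL f)) (at-take< v i<n∸q) ⟩
      Maybe.map (actL f) (at v i)                       ∎
      where
      i<n∸q : i < length v ∸ q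
      i<n∸q = m+n≤o⇒m≤o∸n (suc i) i+q<n

  Shifts⇒IsPeriod : ∀ {f q v} → 1 ≤ q → q ≤ length v → Shifts f q v → IsPeriod q v
  Shifts⇒IsPeriod {f} {q} {v} 1≤q q≤n shifts = 1≤q , q≤n , f , at-ext _ _ pointwise
    where
    pointwise : ∀ i → at (act f (take (length v ∸ q) v)) i ≡ at (drop q v) i
    pointwise i rewrite at-map (actL f) (take (length v ∸ q) v) i | at-drop q v i
      with i <? length v ∸ q
    ... | yes i<n∸q = begin
      Maybe.map (actL f) (at (take (length v ∸ q) v) i) ≡⟨ cong (Maybe.map (actL f)) (at-take< v i<n∸q) ⟩
      Maybe.map (actL f) (at v i)                       ≡⟨ sym (shift shifts i (m≤o∸n⇒m+n≤o (suc i) q≤n i<n∸q)) ⟩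
      at v (i + q)                                      ≡⟨ cong (at v) (+-comm i q) ⟩
      at v (q + i)                                      ∎
    ... | no i≮n∸q = trans (cong (Maybe.map (actL f)) (at-take≥ v (≮⇒≥ i≮n∸q)))
                           (sym (at-≥length v (≤-trans (m≤n+m∸n (length v) q) (+-monoʳ-≤ q (≮⇒≥ i≮n∸q)))))

  Shifts-^ : ∀ {f q v} → Shifts f q v → ∀ j → Shifts (f ^ j) (j * q) v
  Shifts-^ {f} {q} {v} shifts zero .shift i _ = begin
    at v (i + 0)                        ≡⟨ cong (at v) (+-identityʳ i) ⟩
    at v i                              ≡⟨ sym (map-id (at v i)) ⟩
    Maybe.map id (at v i)               ≡⟨ sym (map-cong actL-id (at v i)) ⟩
    Maybe.map (actL (↔-id P)) (at v i)  ∎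
  Shifts-^ {f} {q} {v} shifts (suc j) .shift i i+q+jq<n = begin
    at v (i + (q + j * q))                               ≡⟨ cong (at v) (regroup i q (j * q)) ⟩
    at v (i + j * q + q)                                 ≡⟨ shift shifts (i + j * q) (subst (_< length v) (regroup i q (j * q)) i+q+jq<n) ⟩
    Maybe.map (actL f) (at v (i + j * q))                ≡⟨ cong (Maybe.map (actL f)) (shift (Shifts-^ shifts j) i i+jq<n) ⟩
    Maybe.map (actL f) (Maybe.map (actL (f ^ j)) (at v i)) ≡⟨ sym (map-∘ (at v i)) ⟩
    Maybe.map (actL f ∘ actL (f ^ j)) (at v i)           ≡⟨ sym (map-cong (actL-∘ f (f ^ j)) (at v i)) ⟩
    Maybe.map (actL (f ^ suc j)) (at v i)                ∎
    where
    regroup : ∀ i q x → i + (q + x) ≡ i + x + q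
    regroup = solve 3 (λ i q x → i :+ (q :+ x) := i :+ x :+ q) refl
    i+jq<n : i + j * q < length v
    i+jq<n = ≤-<-trans (+-monoʳ-≤ i (m≤n+m (j * q) q)) i+q+jq<n

  IsPeriod-multiple : ∀ {p ℓ v} → IsPeriod p v → 1 ≤ ℓ → ℓ * p ≤ length v → IsPeriod (ℓ * p) v
  IsPeriod-multiple {ℓ = ℓ} per 1≤ℓ ℓp≤n with IsPeriod⇒Shifts per
  ... | f , shifts = Shifts⇒IsPeriod (*-mono-≤ 1≤ℓ (proj₁ per)) ℓp≤n (Shifts-^ shifts ℓ)

  Shifts-prefix : ∀ {g q} v {u} → Shifts g q (v ++ u) → Shifts g q v
  Shifts-prefix {g} {q} v shifts .shift i i+q<n = begin
    at v (i + q)                       ≡⟨ sym (at-++ˡ v i+q<n) ⟩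
    at (v ++ _) (i + q)                ≡⟨ shift shifts i (≤-trans i+q<n (length-++-≤ˡ v)) ⟩
    Maybe.map (actL g) (at (v ++ _) i) ≡⟨ cong (Maybe.map (actL g)) (at-++ˡ v (≤-<-trans (m≤m+n i q) i+q<n)) ⟩
    Maybe.map (actL g) (at v i)        ∎

  Shifts-agree : ∀ {g h q v e b} → Shifts g q v → Shifts h q v →
                 e + q < length v → at v e ≡ just b → actL g b ≡ actL h b
  Shifts-agree {g} {h} {q} {v} {e} {b} g-shifts h-shifts e+q<n ve≡b = just-injective (begin
    just (actL g b)                ≡⟨ cong (Maybe.map (actL g)) (sym ve≡b) ⟩
    Maybe.map (actL g) (at v e)    ≡⟨ sym (shift g-shifts e e+q<n) ⟩
    at v (e + q)                   ≡⟨ shift h-shifts e e+q<n ⟩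
    Maybe.map (actL h) (at v e)    ≡⟨ cong (Maybe.map (actL h)) ve≡b ⟩
    just (actL h b)                ∎)

  Shifts-snoc : ∀ {f p w a} → 1 ≤ p → Shifts f p w →
                (∀ {i c} → i + p ≡ length w → at w i ≡ just c → a ≡ actL f c) →
                Shifts f p (w ++ [ a ])
  Shifts-snoc {f} {p} {w} {a} 1≤p shifts last .shift i i+p<n+1 with i + p <? length w
  ... | yes i+p<n = begin
    at (w ++ [ a ]) (i + p)               ≡⟨ at-++ˡ w i+p<n ⟩
    at w (i + p)                          ≡⟨ shift shifts i i+p<n ⟩
    Maybe.map (actL f) (at w i)           ≡⟨ cong (Maybe.map (actL f)) (sym (at-++ˡ w (≤-<-trans (m≤m+n i p) i+p<n))) ⟩
    Maybe.map (actL f) (at (w ++ [ a ]) i) ∎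
  ... | no i+p≮n = begin
    at (w ++ [ a ]) (i + p)                ≡⟨ cong (at (w ++ [ a ])) i+p≡n ⟩
    at (w ++ [ a ]) (length w)             ≡⟨ at-length-++ w ⟩
    just a                                 ≡⟨ cong just (last i+p≡n (proj₂ wi)) ⟩
    just (actL f (proj₁ wi))               ≡⟨ cong (Maybe.map (actL f)) (sym (trans (at-++ˡ w i<n) (proj₂ wi))) ⟩
    Maybe.map (actL f) (at (w ++ [ a ]) i) ∎
    where
    i+p≡n : i + p ≡ length w
    i+p≡n = ≤-antisym (s≤s⁻¹ (subst (i + p <_) (length-++-comm w [ a ]) i+p<n+1)) (≮⇒≥ i+p≮n)
    i<n : i < length w
    i<n = subst (i <_) i+p≡n (m<m+n i 1≤p)
    wi : ∃ λ c → at w i ≡ just c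
    wi = at-<⇒just w i<n

  module _ (_≟_ : DecidableEquality P) where

    paramOr : P → Maybe Letter → P
    paramOr _ (just (inj₂ σ)) = σ
    paramOr π _               = π

    orbit-repeats : ∀ F (xs : List P) (y : ℕ → Maybe Letter) →
      Recurrence (Maybe.map (actL F)) (length xs) y →
      (∀ u {σ} → u ≤ length xs → y u ≡ just (inj₂ σ) → σ ∈ xs) →
      ∀ {π} → y (length xs) ≡ just (inj₂ π) → ∃ λ e → e < length xs × y e ≡ just (inj₂ π)
    orbit-repeats F xs y rec y∈xs {π} yk≡π = repeat (pigeonhole-∈ xs σ σ∈xs)
      where
      k : ℕ
      k = length xs
      σ : ℕ → P
      σ u = paramOr π (y u)

      -- Letters of Σ, and the junk value nothing, are fixed by the recurrence, so they
      -- would propagate to the parameter y k.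
      y≡σ : ∀ u → u ≤ k → y u ≡ just (inj₂ (σ u))
      y≡σ u u≤k with y u in yu
      ... | just (inj₂ _) = refl
      ... | just (inj₁ _) with () ← trans (sym yk≡π) (recurrence-fixed (Maybe.map (actL F)) rec refl yu u≤k)
      ... | nothing with () ← trans (sym yk≡π) (recurrence-fixed (Maybe.map (actL F)) rec refl yu u≤k)

      σ∈xs : ∀ u → u ≤ k → σ u ∈ xs
      σ∈xs u u≤k = y∈xs u u≤k (y≡σ u u≤k)

      repeat : (∃₂ λ u v → u < v × v ≤ k × σ u ≡ σ v) → ∃ λ e → e < k × y e ≡ just (inj₂ π)
      repeat (u , v , u<v , v≤k , σu≡σv) = u + (k ∸ v) , e<k , (begin
        y (u + (k ∸ v)) ≡⟨ recurrence-shift (Maybe.map (actL F)) rec (<⇒≤ u<v) yu≡yv (k ∸ v) (≤-reflexive v+[k∸v]≡k) ⟩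
        y (v + (k ∸ v)) ≡⟨ cong y v+[k∸v]≡k ⟩
        y k             ≡⟨ yk≡π ⟩
        just (inj₂ π)   ∎)
        where
        v+[k∸v]≡k : v + (k ∸ v) ≡ k
        v+[k∸v]≡k = m+[n∸m]≡n v≤k
        yu≡yv : y u ≡ y v
        yu≡yv = trans (y≡σ u (≤-trans (<⇒≤ u<v) v≤k))
                      (trans (cong (just ∘ inj₂) σu≡σv) (sym (y≡σ v v≤k)))
        e<k : u + (k ∸ v) < k
        e<k = subst (u + (k ∸ v) <_) v+[k∸v]≡k (+-monoˡ-< (k ∸ v) u<v)

    earlier-occurrence : ∀ {F q w j π} → Shifts F q w →
      q * (numParams _≟_ w + 1) ≤ length w → j + q ≡ length w → at w j ≡ just (inj₂ π) →
      ∃ λ e → e + q < length w × at w e ≡ just (inj₂ π)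
    earlier-occurrence {F} {q} {w} {j} {π} shifts bound j+q≡n wj≡π =
      earlier (orbit-repeats F xs y rec y∈xs yk≡π)
      where
      xs : List P
      xs = deduplicate _≟_ (params w)
      k : ℕ
      k = length xs
      o : ℕ
      o = proj₁ (m≤n⇒∃[o]m+o≡n bound)

      y : ℕ → Maybe Letter
      y u = at w (o + u * q)

      o+kq≡j : o + k * q ≡ j
      o+kq≡j = +-cancelʳ-≡ q (o + k * q) j (begin
        o + k * q + q     ≡⟨ solve 3 (λ o k q → o :+ k :* q :+ q := q :* (k :+ con 1) :+ o) refl o k q ⟩
        q * (k + 1) + o   ≡⟨ proj₂ (m≤n⇒∃[o]m+o≡n bound) ⟩
        length w          ≡⟨ sym j+q≡n ⟩
        j + q             ∎)

      next : ∀ u → o + u * q + q ≡ o + suc u * q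
      next u = solve 3 (λ o u q → o :+ u :* q :+ q := o :+ (con 1 :+ u) :* q) refl o u q

      j<n : j < length w
      j<n = at-just⇒< w wj≡π

      block-end : ∀ u → u < k → o + u * q + q ≤ j
      block-end u u<k = subst₂ _≤_ (sym (next u)) o+kq≡j (+-monoʳ-≤ o (*-monoˡ-≤ q u<k))

      rec : Recurrence (Maybe.map (actL F)) k y
      rec u u<k = trans (cong (at w) (sym (next u))) (shift shifts (o + u * q) (≤-<-trans (block-end u u<k) j<n))

      y∈xs : ∀ u {σ} → u ≤ k → y u ≡ just (inj₂ σ) → σ ∈ xs
      y∈xs u _ yu≡σ = ∈-deduplicate⁺ _≟_ (at-∈-params w yu≡σ)

      yk≡π : y k ≡ just (inj₂ π)
      yk≡π = trans (cong (at w) o+kq≡j) wj≡π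

      earlier : (∃ λ e → e < k × y e ≡ just (inj₂ π)) → ∃ λ e → e + q < length w × at w e ≡ just (inj₂ π)
      earlier (e , e<k , ye≡π) = o + e * q , ≤-<-trans (block-end e e<k) j<n , ye≡π

    Shifts-agree-last-block : ∀ {g F q w a j b} → Shifts g q (w ++ [ a ]) → Shifts F q w →
      q * (numParams _≟_ w + 1) ≤ length w → j + q ≡ length w → at w j ≡ just b →
      actL g b ≡ actL F b
    Shifts-agree-last-block {b = inj₁ _} _ _ _ _ _ = refl
    Shifts-agree-last-block {g} {F} {q} {w} {b = inj₂ π} g-shifts F-shifts bound j+q≡n wj≡b =
      agree (earlier-occurrence F-shifts bound j+q≡n wj≡b)
      where
      agree : (∃ λ e → e + q < length w × at w e ≡ just (inj₂ π)) → actL g (inj₂ π) ≡ actL F (inj₂ π)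
      agree (e , e+q<n , we≡b) = Shifts-agree (Shifts-prefix w g-shifts) F-shifts e+q<n we≡b

    Shifts-appended : ∀ {g q w a j b} → Shifts g q (w ++ [ a ]) → j + q ≡ length w → at w j ≡ just b →
      a ≡ actL g b
    Shifts-appended {g} {q} {w} {a} {j} {b} g-shifts j+q≡n wj≡b = just-injective (begin
      just a                                 ≡⟨ sym (at-length-++ w) ⟩
      at (w ++ [ a ]) (length w)             ≡⟨ cong (at (w ++ [ a ])) (sym j+q≡n) ⟩
      at (w ++ [ a ]) (j + q)                ≡⟨ shift g-shifts j (subst (_< length (w ++ [ a ])) (sym j+q≡n) n<n+1) ⟩
      Maybe.map (actL g) (at (w ++ [ a ]) j) ≡⟨ cong (Maybe.map (actL g)) (trans (at-++ˡ w j<n) wj≡b) ⟩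
      just (actL g b)                        ∎)
      where
      n<n+1 : length w < length (w ++ [ a ])
      n<n+1 = ≤-reflexive (sym (length-++-comm w [ a ]))
      j<n : j < length w
      j<n = at-just⇒< w wj≡b

    last-letter : ∀ {f g p ℓ w a i c} → 1 ≤ ℓ → Shifts f p w → Shifts g (ℓ * p) (w ++ [ a ]) →
      (ℓ * p) * (numParams _≟_ w + 1) ≤ length w →
      i + p ≡ length w → at w i ≡ just c → a ≡ actL f c
    last-letter {f} {g} {p} {suc ℓ'} {w} {a} {i} {c} _ f-shifts g-shifts bound i+p≡n wi≡c = begin
      a                         ≡⟨ Shifts-appended g-shifts j+q≡n wj≡b ⟩
      actL g b                  ≡⟨ Shifts-agree-last-block g-shifts (Shifts-^ f-shifts (suc ℓ')) bound j+q≡n wj≡b ⟩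
      actL (f ^ suc ℓ') b        ≡⟨ actL-∘ f (f ^ ℓ') b ⟩
      actL f (actL (f ^ ℓ') b)   ≡⟨ cong (actL f) (sym c≡f^ℓ'b) ⟩
      actL f c                  ∎
      where
      ℓ'p≤i : ℓ' * p ≤ i
      ℓ'p≤i = +-cancelʳ-≤ p (ℓ' * p) i (subst₂ _≤_ (+-comm p (ℓ' * p)) (sym i+p≡n) (m*[k+1]≤n⇒m≤n bound))
      j : ℕ
      j = i ∸ ℓ' * p
      j+ℓ'p≡i : j + ℓ' * p ≡ i
      j+ℓ'p≡i = m∸n+n≡m ℓ'p≤i
      j+q≡n : j + suc ℓ' * p ≡ length w
      j+q≡n = begin
        j + (p + ℓ' * p) ≡⟨ solve 3 (λ j p x → j :+ (p :+ x) := j :+ x :+ p) refl j p (ℓ' * p) ⟩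
        j + ℓ' * p + p   ≡⟨ cong (_+ p) j+ℓ'p≡i ⟩
        i + p            ≡⟨ i+p≡n ⟩
        length w         ∎
      j+ℓ'p<n : j + ℓ' * p < length w
      j+ℓ'p<n = subst (_< length w) (sym j+ℓ'p≡i) (at-just⇒< w wi≡c)
      letter-at-j : ∃ λ b → at w j ≡ just b
      letter-at-j = at-<⇒just w (≤-<-trans (m≤m+n j (ℓ' * p)) j+ℓ'p<n)
      b : Letter
      b = proj₁ letter-at-j
      wj≡b : at w j ≡ just b
      wj≡b = proj₂ letter-at-j
      c≡f^ℓ'b : c ≡ actL (f ^ ℓ') b
      c≡f^ℓ'b = just-injective (begin
        just c                              ≡⟨ sym wi≡c ⟩
        at w i                              ≡⟨ cong (at w) (sym j+ℓ'p≡i) ⟩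
        at w (j + ℓ' * p)                   ≡⟨ shift (Shifts-^ f-shifts ℓ') j j+ℓ'p<n ⟩
        Maybe.map (actL (f ^ ℓ')) (at w j)  ≡⟨ cong (Maybe.map (actL (f ^ ℓ'))) wj≡b ⟩
        just (actL (f ^ ℓ') b)              ∎)

    IsPeriod-snoc-from-multiple : ∀ {p ℓ w a} → IsPeriod p w → IsPeriod (ℓ * p) (w ++ [ a ]) → 1 ≤ ℓ →
      (ℓ * p) * (numParams _≟_ w + 1) ≤ length w → IsPeriod p (w ++ [ a ])
    IsPeriod-snoc-from-multiple {p} {w = w} per-p per-ℓp 1≤ℓ bound
      with f , f-shifts ← IsPeriod⇒Shifts per-p
         | g , g-shifts ← IsPeriod⇒Shifts per-ℓp
      = Shifts⇒IsPeriod 1≤p (≤-trans (proj₁ (proj₂ per-p)) (length-++-≤ˡ w))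
          (Shifts-snoc 1≤p f-shifts (last-letter 1≤ℓ f-shifts g-shifts bound))
      where
      1≤p : 1 ≤ p
      1≤p = proj₁ per-p

corollary2 : (S P : Set) → (_≟_ : DecidableEquality P) →
    let open PString S P in
    (w : PStr) (p : ℕ) → IsPeriod p w →
    (ℓ : ℕ) → 1 ≤ ℓ → (ℓ * p) * (numParams _≟_ w + 1) ≤ length w →
    (a : Letter) →
    IsPeriod p (w ++ [ a ]) ⇔ IsPeriod (ℓ * p) (w ++ [ a ])
corollary2 S P _≟_ w p per-p ℓ 1≤ℓ bound a = mk⇔
  (λ per-p′ → IsPeriod-multiple per-p′ 1≤ℓ (≤-trans (m*[k+1]≤n⇒m≤n bound) (length-++-≤ˡ w)))
  (λ per-ℓp → IsPeriod-snoc-from-multiple _≟_ per-p per-ℓp 1≤ℓ bound)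
  where open Periods S P
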